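{- The system $\lambda_{\mathrm{alg}}+\mathrm{itco}$ is Turing-complete: for every partial recursive function $f:\mathbb{N}^n\rightharpoonup\mathbb{N}$ there is a term of the system of type $\mathbb{N}^n\to\mathbb{N}$ whose evaluation on an input $\vec x$ terminates with result $y$ exactly when $f(\vec x)$ is defined and equal to $y$, and does not terminate when $f(\vec x)$ is undefined.
   Context: $\lambda_{\mathrm{alg}}$ is a typed $\lambda$-calculus containing algebraic data types (in particular the natural numbers $\mathbb{N}$, products and binary sums $A+B$ with injections $\mathsf{inl},\mathsf{inr}$) with definition by cases, and function types with $\lambda$-abstraction and application. The rule $\mathrm{itco}$ adds, for every term $g:A\to A+B$, a term $\mathsf{itcompute}\,g:A\to B$ with the following computation behaviour: for $a:A$, if $g\,a=\mathsf{inr}\,b$ then $(\mathsf{itcompute}\,g)\,a$ evaluates to $b$; if $g\,a=\mathsf{inl}\,a'$ then $(\mathsf{itcompute}\,g)\,a$ reduces to $(\mathsf{itcompute}\,g)\,a'$ and the evaluation continues; if this process never reaches an $\mathsf{inr}$ case, the computation does not terminate. Partial recursive functions are those generated from zero, successor and projections by composition, primitive recursion and minimization. -}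

module Defs where

open import Data.Nat using (ℕ; zero; suc; _<_)
open import Data.Fin using (Fin)
open import Data.Vec using (Vec; []; _∷_; lookup)
open import Data.List using (List; []; _∷_)
open import Data.Product using (Σ)

infixr 7 _⊗_
infixr 6 _⊕_
infixr 5 _⇒_
data Ty : Set where
  nat  : Ty
  unit : Ty
  _⊗_  : Ty → Ty → Ty
  _⊕_  : Ty → Ty → Ty
  _⇒_  : Ty → Ty → Ty

Ctx : Set
Ctx = List Ty

data _∋_ : Ctx → Ty → Set where
  here  : ∀ {Γ A} → (A ∷ Γ) ∋ A
  there : ∀ {Γ A B} → Γ ∋ A → (B ∷ Γ) ∋ A

-- Intrinsically typed terms (de Bruijn).  Algebraic data types are
-- eliminated by definition by cases only (no built-in recursion).
data Tm (Γ : Ctx) : Ty → Set where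
  var   : ∀ {A} → Γ ∋ A → Tm Γ A
  lam   : ∀ {A B} → Tm (A ∷ Γ) B → Tm Γ (A ⇒ B)
  app   : ∀ {A B} → Tm Γ (A ⇒ B) → Tm Γ A → Tm Γ B
  zeroT : Tm Γ nat
  sucT  : Tm Γ nat → Tm Γ nat
  caseN : ∀ {C} → Tm Γ nat → Tm Γ C → Tm (nat ∷ Γ) C → Tm Γ C
  tt    : Tm Γ unit
  pair  : ∀ {A B} → Tm Γ A → Tm Γ B → Tm Γ (A ⊗ B)
  fst   : ∀ {A B} → Tm Γ (A ⊗ B) → Tm Γ A
  snd   : ∀ {A B} → Tm Γ (A ⊗ B) → Tm Γ B
  inl   : ∀ {A B} → Tm Γ A → Tm Γ (A ⊕ B)
  inr   : ∀ {A B} → Tm Γ B → Tm Γ (A ⊕ B)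
  caseS : ∀ {A B C} → Tm Γ (A ⊕ B) → Tm (A ∷ Γ) C → Tm (B ∷ Γ) C → Tm Γ C
  itcompute : ∀ {A B} → Tm Γ (A ⇒ A ⊕ B) → Tm Γ (A ⇒ B)

data Val : Ty → Set
data Env : Ctx → Set

data Val where
  num   : ℕ → Val nat
  ttV   : Val unit
  pairV : ∀ {A B} → Val A → Val B → Val (A ⊗ B)
  inlV  : ∀ {A B} → Val A → Val (A ⊕ B)
  inrV  : ∀ {A B} → Val B → Val (A ⊕ B)
  clo   : ∀ {Γ A B} → Env Γ → Tm (A ∷ Γ) B → Val (A ⇒ B)
  itV   : ∀ {A B} → Val (A ⇒ A ⊕ B) → Val (A ⇒ B)

data Env where
  []  : Env []
  _∷_ : ∀ {A Γ} → Val A → Env Γ → Env (A ∷ Γ)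

lookupEnv : ∀ {Γ A} → Env Γ → Γ ∋ A → Val A
lookupEnv (v ∷ ρ) here      = v
lookupEnv (v ∷ ρ) (there x) = lookupEnv ρ x

-- Evaluation:  ρ ⊢ t ⇓ v  ("evaluation of t in ρ terminates with v"),
-- and  f · a ⇓ v  (application of a function value).
-- Non-termination = no derivation exists.
infix 4 _⊢_⇓_ _·_⇓_
data _⊢_⇓_ : ∀ {Γ A} → Env Γ → Tm Γ A → Val A → Set
data _·_⇓_ : ∀ {A B} → Val (A ⇒ B) → Val A → Val B → Set

data _⊢_⇓_ where
  ⇓var   : ∀ {Γ A} {ρ : Env Γ} {x : Γ ∋ A} → ρ ⊢ var x ⇓ lookupEnv ρ x
  ⇓lam   : ∀ {Γ A B} {ρ : Env Γ} {t : Tm (A ∷ Γ) B} → ρ ⊢ lam t ⇓ clo ρ t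
  ⇓app   : ∀ {Γ A B} {ρ : Env Γ} {t : Tm Γ (A ⇒ B)} {u f v r} →
           ρ ⊢ t ⇓ f → ρ ⊢ u ⇓ v → f · v ⇓ r → ρ ⊢ app t u ⇓ r
  ⇓zero  : ∀ {Γ} {ρ : Env Γ} → ρ ⊢ zeroT ⇓ num 0
  ⇓suc   : ∀ {Γ} {ρ : Env Γ} {t n} → ρ ⊢ t ⇓ num n → ρ ⊢ sucT t ⇓ num (suc n)
  ⇓caseN0 : ∀ {Γ C} {ρ : Env Γ} {t} {z : Tm Γ C} {s r} →
            ρ ⊢ t ⇓ num 0 → ρ ⊢ z ⇓ r → ρ ⊢ caseN t z s ⇓ r
  ⇓caseNS : ∀ {Γ C} {ρ : Env Γ} {t} {z : Tm Γ C} {s r n} →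
            ρ ⊢ t ⇓ num (suc n) → (num n ∷ ρ) ⊢ s ⇓ r → ρ ⊢ caseN t z s ⇓ r
  ⇓tt    : ∀ {Γ} {ρ : Env Γ} → ρ ⊢ tt ⇓ ttV
  ⇓pair  : ∀ {Γ A B} {ρ : Env Γ} {t : Tm Γ A} {u : Tm Γ B} {a b} →
           ρ ⊢ t ⇓ a → ρ ⊢ u ⇓ b → ρ ⊢ pair t u ⇓ pairV a b
  ⇓fst   : ∀ {Γ A B} {ρ : Env Γ} {t : Tm Γ (A ⊗ B)} {a b} →
           ρ ⊢ t ⇓ pairV a b → ρ ⊢ fst t ⇓ a
  ⇓snd   : ∀ {Γ A B} {ρ : Env Γ} {t : Tm Γ (A ⊗ B)} {a b} →
           ρ ⊢ t ⇓ pairV a b → ρ ⊢ snd t ⇓ b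
  ⇓inl   : ∀ {Γ A B} {ρ : Env Γ} {t : Tm Γ A} {a} →
           ρ ⊢ t ⇓ a → ρ ⊢ inl {B = B} t ⇓ inlV a
  ⇓inr   : ∀ {Γ A B} {ρ : Env Γ} {t : Tm Γ B} {b} →
           ρ ⊢ t ⇓ b → ρ ⊢ inr {A = A} t ⇓ inrV b
  ⇓caseSl : ∀ {Γ A B C} {ρ : Env Γ} {t : Tm Γ (A ⊕ B)} {l : Tm (A ∷ Γ) C} {r a v} →
            ρ ⊢ t ⇓ inlV a → (a ∷ ρ) ⊢ l ⇓ v → ρ ⊢ caseS t l r ⇓ v
  ⇓caseSr : ∀ {Γ A B C} {ρ : Env Γ} {t : Tm Γ (A ⊕ B)} {l : Tm (A ∷ Γ) C} {r b v} →
            ρ ⊢ t ⇓ inrV b → (b ∷ ρ) ⊢ r ⇓ v → ρ ⊢ caseS t l r ⇓ v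
  ⇓itco  : ∀ {Γ A B} {ρ : Env Γ} {g : Tm Γ (A ⇒ A ⊕ B)} {gv} →
           ρ ⊢ g ⇓ gv → ρ ⊢ itcompute g ⇓ itV gv

data _·_⇓_ where
  ·clo   : ∀ {Γ A B} {ρ : Env Γ} {t : Tm (A ∷ Γ) B} {v r} →
           (v ∷ ρ) ⊢ t ⇓ r → clo ρ t · v ⇓ r
  ·itInr : ∀ {A B} {g : Val (A ⇒ A ⊕ B)} {a b} →
           g · a ⇓ inrV b → itV g · a ⇓ b
  ·itInl : ∀ {A B} {g : Val (A ⇒ A ⊕ B)} {a a' b} →
           g · a ⇓ inlV a' → itV g · a' ⇓ b → itV g · a ⇓ b

Natⁿ : ℕ → Ty
Natⁿ zero    = unit
Natⁿ (suc n) = nat ⊗ Natⁿ n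

numeral : ∀ {Γ} → ℕ → Tm Γ nat
numeral zero    = zeroT
numeral (suc k) = sucT (numeral k)

input : ∀ {n} → Vec ℕ n → Tm [] (Natⁿ n)
input []       = tt
input (x ∷ xs) = pair (numeral x) (input xs)

data PR : ℕ → Set where
  zeroF : ∀ {n} → PR n
  succF : PR 1
  proj  : ∀ {n} → Fin n → PR n
  comp  : ∀ {m n} → PR m → Vec (PR n) m → PR n
  prec  : ∀ {n} → PR n → PR (suc (suc n)) → PR (suc n)
  -- prec g h (0, xs) = g xs ; prec g h (k+1, xs) = h (k, prec g h (k,xs), xs)
  mu    : ∀ {n} → PR (suc n) → PR n
  -- mu f xs = least y with f (y, xs) = 0 and f (z, xs) defined for z < y

infix 4 _⟦_⟧≃_ _⟦_⟧*≃_
data _⟦_⟧≃_ : ∀ {n} → PR n → Vec ℕ n → ℕ → Set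
data _⟦_⟧*≃_ : ∀ {m n} → Vec (PR n) m → Vec ℕ n → Vec ℕ m → Set

data _⟦_⟧≃_ where
  ≃zero : ∀ {n} {xs : Vec ℕ n} → zeroF ⟦ xs ⟧≃ 0
  ≃succ : ∀ {x} → succF ⟦ x ∷ [] ⟧≃ suc x
  ≃proj : ∀ {n} {xs : Vec ℕ n} {i} → proj i ⟦ xs ⟧≃ lookup xs i
  ≃comp : ∀ {m n} {f : PR m} {gs : Vec (PR n) m} {xs ys z} →
          gs ⟦ xs ⟧*≃ ys → f ⟦ ys ⟧≃ z → comp f gs ⟦ xs ⟧≃ z
  ≃prec0 : ∀ {n} {g : PR n} {h xs z} →
           g ⟦ xs ⟧≃ z → prec g h ⟦ 0 ∷ xs ⟧≃ z
  ≃precS : ∀ {n} {g : PR n} {h xs k z w} →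
           prec g h ⟦ k ∷ xs ⟧≃ z → h ⟦ k ∷ z ∷ xs ⟧≃ w →
           prec g h ⟦ suc k ∷ xs ⟧≃ w
  ≃mu   : ∀ {n} {f : PR (suc n)} {xs y} →
          f ⟦ y ∷ xs ⟧≃ 0 →
          (∀ z → z < y → Σ ℕ (λ w → f ⟦ z ∷ xs ⟧≃ suc w)) →
          mu f ⟦ xs ⟧≃ y

data _⟦_⟧*≃_ where
  []  : ∀ {n} {xs : Vec ℕ n} → [] ⟦ xs ⟧*≃ []
  _∷_ : ∀ {m n} {g : PR n} {gs : Vec (PR n) m} {xs y ys} →
        g ⟦ xs ⟧≃ y → gs ⟦ xs ⟧*≃ ys → (g ∷ gs) ⟦ xs ⟧*≃ (y ∷ ys)

-- For prec g h the term runs an itcompute loop on states (i, z, r) — counter, accumulator,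
-- remaining steps — started at (0, g xs, k); it keeps the invariant z = prec g h (i, xs) and
-- returns z once r = 0.  For mu f it runs an itcompute loop on a candidate y started at 0 that
-- evaluates f (y, xs) and stops at the first zero; call by value makes it diverge exactly when some
-- earlier f (z, xs) is undefined, as in the definition of minimisation.  Soundness (a terminating
-- evaluation computes f) and completeness (every value of f is computed) are proved by mutual
-- induction; soundness alone shows that the term diverges where f is undefined.
module Submission where

open import Defs
open import Data.Nat using (ℕ; zero; suc; _+_; _<_; _≤‴_; ≤‴-refl; ≤‴-step)
open import Data.Nat.Properties using (+-suc; +-identityʳ; <-cmp; m<1+n⇒m<n∨m≡n; 0≢1+n; ≤‴⇒≤; 0≤‴n)
open import Data.Fin using (Fin)
open import Data.Vec using (Vec; []; _∷_; lookup)
open import Data.List using ([]; _∷_)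
open import Data.Product using (Σ; _×_; _,_; proj₂)
open import Data.Sum using (inj₁; inj₂)
open import Data.Empty using (⊥-elim)
open import Function.Bundles using (_⇔_; mk⇔)
open import Relation.Nullary using (¬_)
open import Relation.Binary using (tri<; tri≈; tri>)
open import Relation.Binary.PropositionalEquality using (_≡_; refl)

encode : ∀ {n} → Vec ℕ n → Val (Natⁿ n)
encode []       = ttV
encode (x ∷ xs) = pairV (num x) (encode xs)

projT : ∀ {n Γ} → Fin n → Tm Γ (Natⁿ n) → Tm Γ nat
projT Fin.zero    t = fst t
projT (Fin.suc i) t = projT i (snd t)

PrecState : Ty
PrecState = nat ⊗ nat ⊗ nat

mutual
  compile : ∀ {n Γ} → PR n → Tm Γ (Natⁿ n ⇒ nat)
  compile f = lam (body f)

  body : ∀ {n Γ} → PR n → Tm (Natⁿ n ∷ Γ) nat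
  body zeroF       = zeroT
  body succF       = sucT (fst (var here))
  body (proj i)    = projT i (var here)
  body (comp f gs) = app (compile f) (tuple gs)
  body (prec g h)  = app (itcompute (lam (precStep h)))
                         (pair zeroT (pair (app (compile g) (snd (var here))) (fst (var here))))
  body (mu f)      = app (itcompute (lam (muStep f))) zeroT

  tuple : ∀ {m n Γ} → Vec (PR n) m → Tm (Natⁿ n ∷ Γ) (Natⁿ m)
  tuple []       = tt
  tuple (g ∷ gs) = pair (app (compile g) (var here)) (tuple gs)

  -- Under the caseN binder, var (there here) is the state (i, z, r) and
  -- var (there (there here)) the input (k, xs).
  precStep : ∀ {n Γ} → PR (suc (suc n)) → Tm (PrecState ∷ Natⁿ (suc n) ∷ Γ) (PrecState ⊕ nat)
  precStep h =
    caseN (snd (snd (var here)))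
      (inr (fst (snd (var here))))
      (inl (pair (sucT (fst (var (there here))))
                 (pair (app (compile h) (pair (fst (var (there here)))
                                              (pair (fst (snd (var (there here))))
                                                    (snd (var (there (there here)))))))
                       (var here))))

  muStep : ∀ {n Γ} → PR (suc n) → Tm (nat ∷ Natⁿ n ∷ Γ) (nat ⊕ nat)
  muStep f =
    caseN (app (compile f) (pair (var here) (var (there here))))
      (inr (var here))
      (inl (sucT (var (there here))))

mutual
  ⇓-deterministic : ∀ {Γ A} {ρ : Env Γ} {t : Tm Γ A} {v w} → ρ ⊢ t ⇓ v → ρ ⊢ t ⇓ w → v ≡ w
  ⇓-deterministic ⇓var ⇓var = refl
  ⇓-deterministic ⇓lam ⇓lam = refl
  ⇓-deterministic (⇓app dt du df) (⇓app dt′ du′ df′)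
    with ⇓-deterministic dt dt′ | ⇓-deterministic du du′
  ... | refl | refl = ·⇓-deterministic df df′
  ⇓-deterministic ⇓zero ⇓zero = refl
  ⇓-deterministic (⇓suc d) (⇓suc d′) with ⇓-deterministic d d′
  ... | refl = refl
  ⇓-deterministic (⇓caseN0 _ dz) (⇓caseN0 _ dz′) = ⇓-deterministic dz dz′
  ⇓-deterministic (⇓caseN0 d _) (⇓caseNS d′ _) with ⇓-deterministic d d′
  ... | ()
  ⇓-deterministic (⇓caseNS d _) (⇓caseN0 d′ _) with ⇓-deterministic d d′
  ... | ()
  ⇓-deterministic (⇓caseNS d ds) (⇓caseNS d′ ds′) with ⇓-deterministic d d′
  ... | refl = ⇓-deterministic ds ds′
  ⇓-deterministic ⇓tt ⇓tt = refl
  ⇓-deterministic (⇓pair da db) (⇓pair da′ db′)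
    with ⇓-deterministic da da′ | ⇓-deterministic db db′
  ... | refl | refl = refl
  ⇓-deterministic (⇓fst d) (⇓fst d′) with ⇓-deterministic d d′
  ... | refl = refl
  ⇓-deterministic (⇓snd d) (⇓snd d′) with ⇓-deterministic d d′
  ... | refl = refl
  ⇓-deterministic (⇓inl d) (⇓inl d′) with ⇓-deterministic d d′
  ... | refl = refl
  ⇓-deterministic (⇓inr d) (⇓inr d′) with ⇓-deterministic d d′
  ... | refl = refl
  ⇓-deterministic (⇓caseSl d dl) (⇓caseSl d′ dl′) with ⇓-deterministic d d′
  ... | refl = ⇓-deterministic dl dl′
  ⇓-deterministic (⇓caseSl d _) (⇓caseSr d′ _) with ⇓-deterministic d d′
  ... | ()
  ⇓-deterministic (⇓caseSr d _) (⇓caseSl d′ _) with ⇓-deterministic d d′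
  ... | ()
  ⇓-deterministic (⇓caseSr d dr) (⇓caseSr d′ dr′) with ⇓-deterministic d d′
  ... | refl = ⇓-deterministic dr dr′
  ⇓-deterministic (⇓itco d) (⇓itco d′) with ⇓-deterministic d d′
  ... | refl = refl

  ·⇓-deterministic : ∀ {A B} {f : Val (A ⇒ B)} {a v w} → f · a ⇓ v → f · a ⇓ w → v ≡ w
  ·⇓-deterministic (·clo d) (·clo d′) = ⇓-deterministic d d′
  ·⇓-deterministic (·itInr d) (·itInr d′) with ·⇓-deterministic d d′
  ... | refl = refl
  ·⇓-deterministic (·itInr d) (·itInl d′ _) with ·⇓-deterministic d d′
  ... | ()
  ·⇓-deterministic (·itInl d _) (·itInr d′) with ·⇓-deterministic d d′
  ... | ()
  ·⇓-deterministic (·itInl d e) (·itInl d′ e′) with ·⇓-deterministic d d′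
  ... | refl = ·⇓-deterministic e e′

mutual
  ≃-deterministic : ∀ {n} {f : PR n} {xs y y′} → f ⟦ xs ⟧≃ y → f ⟦ xs ⟧≃ y′ → y ≡ y′
  ≃-deterministic ≃zero ≃zero = refl
  ≃-deterministic ≃succ ≃succ = refl
  ≃-deterministic ≃proj ≃proj = refl
  ≃-deterministic (≃comp G F) (≃comp G′ F′) with ≃*-deterministic G G′
  ... | refl = ≃-deterministic F F′
  ≃-deterministic (≃prec0 G) (≃prec0 G′) = ≃-deterministic G G′
  ≃-deterministic (≃precS P H) (≃precS P′ H′) with ≃-deterministic P P′
  ... | refl = ≃-deterministic H H′
  ≃-deterministic (≃mu {y = y} F L) (≃mu {y = y′} F′ L′) with <-cmp y y′
  ... | tri< y<y′ _ _ = ⊥-elim (0≢1+n (≃-deterministic F (proj₂ (L′ y y<y′))))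
  ... | tri≈ _ y≡y′ _ = y≡y′
  ... | tri> _ _ y′<y = ⊥-elim (0≢1+n (≃-deterministic F′ (proj₂ (L y′ y′<y))))

  ≃*-deterministic : ∀ {m n} {gs : Vec (PR n) m} {xs ys ys′} →
    gs ⟦ xs ⟧*≃ ys → gs ⟦ xs ⟧*≃ ys′ → ys ≡ ys′
  ≃*-deterministic [] [] = refl
  ≃*-deterministic (G ∷ Gs) (G′ ∷ Gs′) with ≃-deterministic G G′ | ≃*-deterministic Gs Gs′
  ... | refl | refl = refl

prec-defined-below : ∀ {n} {g : PR n} {h xs w} k r →
  prec g h ⟦ k + r ∷ xs ⟧≃ w → Σ ℕ λ z → prec g h ⟦ k ∷ xs ⟧≃ z
prec-defined-below k zero P rewrite +-identityʳ k = _ , P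
prec-defined-below k (suc r) P rewrite +-suc k r with P
... | ≃precS P′ _ = prec-defined-below k r P′

below-suc : ∀ {p} {P : ℕ → Set p} {y} →
  (∀ z → z < y → P z) → P y → ∀ z → z < suc y → P z
below-suc below at z z<1+y with m<1+n⇒m<n∨m≡n z<1+y
... | inj₁ z<y  = below z z<y
... | inj₂ refl = at

projT-⇓ : ∀ {n Γ} {ρ : Env Γ} (i : Fin n) {xs : Vec ℕ n} {t} →
  ρ ⊢ t ⇓ encode xs → ρ ⊢ projT i t ⇓ num (lookup xs i)
projT-⇓ Fin.zero    {x ∷ xs} d = ⇓fst d
projT-⇓ (Fin.suc i) {x ∷ xs} d = projT-⇓ i (⇓snd d)

CompileSound : ∀ {n} → PR n → Set
CompileSound {n} f = ∀ {Γ} {ρ : Env Γ} {u xs y} →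
  ρ ⊢ u ⇓ encode xs → ρ ⊢ app (compile f) u ⇓ num y → f ⟦ xs ⟧≃ y

CompileComplete : ∀ {n} → PR n → Set
CompileComplete {n} f = ∀ {Γ} {ρ : Env Γ} {u xs y} →
  ρ ⊢ u ⇓ encode xs → f ⟦ xs ⟧≃ y → ρ ⊢ app (compile f) u ⇓ num y

PrecLoop : ∀ {n Γ} → Env Γ → PR (suc (suc n)) → ℕ → Vec ℕ n → Val (PrecState ⇒ nat)
PrecLoop ρ h k xs = itV (clo (encode (k ∷ xs) ∷ ρ) (precStep h))

precState : ℕ → ℕ → ℕ → Val PrecState
precState i z r = pairV (num i) (pairV (num z) (num r))

precLoop-sound : ∀ {n Γ} {ρ : Env Γ} (g : PR n) (h : PR (suc (suc n))) → CompileSound h →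
  ∀ {k xs i z r y} → PrecLoop ρ h k xs · precState i z r ⇓ num y →
  prec g h ⟦ i ∷ xs ⟧≃ z → prec g h ⟦ i + r ∷ xs ⟧≃ y
precLoop-sound g h h-sound {i = i}
  (·itInr (·clo (⇓caseN0 (⇓snd (⇓snd ⇓var)) (⇓inr (⇓fst (⇓snd ⇓var)))))) P
  rewrite +-identityʳ i = P
precLoop-sound g h h-sound (·itInr (·clo (⇓caseNS _ ()))) P
precLoop-sound g h h-sound (·itInl (·clo (⇓caseN0 _ ())) _) P
precLoop-sound g h h-sound {i = i}
  (·itInl {a' = pairV (num _) (pairV (num _) (num r))}
    (·clo (⇓caseNS (⇓snd (⇓snd ⇓var)) (⇓inl (⇓pair (⇓suc (⇓fst ⇓var)) (⇓pair dh ⇓var)))))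
    loop) P
  rewrite +-suc i r =
  precLoop-sound g h h-sound loop
    (≃precS P (h-sound (⇓pair (⇓fst ⇓var) (⇓pair (⇓fst (⇓snd ⇓var)) (⇓snd ⇓var))) dh))

precLoop-complete : ∀ {n Γ} {ρ : Env Γ} (g : PR n) (h : PR (suc (suc n))) → CompileComplete h →
  ∀ {k xs i z y} r → prec g h ⟦ i ∷ xs ⟧≃ z → prec g h ⟦ i + r ∷ xs ⟧≃ y →
  PrecLoop ρ h k xs · precState i z r ⇓ num y
precLoop-complete g h h-complete {i = i} zero P Q rewrite +-identityʳ i
  with ≃-deterministic P Q
... | refl = ·itInr (·clo (⇓caseN0 (⇓snd (⇓snd ⇓var)) (⇓inr (⇓fst (⇓snd ⇓var)))))
precLoop-complete g h h-complete {i = i} (suc r) P Q rewrite +-suc i r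
  with prec-defined-below (suc i) r Q
... | _ , ≃precS P′ H with ≃-deterministic P′ P
... | refl =
  ·itInl (·clo (⇓caseNS (⇓snd (⇓snd ⇓var))
           (⇓inl (⇓pair (⇓suc (⇓fst ⇓var))
             (⇓pair (h-complete (⇓pair (⇓fst ⇓var) (⇓pair (⇓fst (⇓snd ⇓var)) (⇓snd ⇓var))) H)
                    ⇓var)))))
         (precLoop-complete g h h-complete r (≃precS P H) Q)

MuLoop : ∀ {n Γ} → Env Γ → PR (suc n) → Vec ℕ n → Val (nat ⇒ nat)
MuLoop ρ f xs = itV (clo (encode xs ∷ ρ) (muStep f))

muLoop-sound : ∀ {n Γ} {ρ : Env Γ} (f : PR (suc n)) → CompileSound f → ∀ {xs y₀ y} →
  MuLoop ρ f xs · num y₀ ⇓ num y →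
  (∀ z → z < y₀ → Σ ℕ λ w → f ⟦ z ∷ xs ⟧≃ suc w) → mu f ⟦ xs ⟧≃ y
muLoop-sound f f-sound (·itInr (·clo (⇓caseN0 df (⇓inr ⇓var)))) below =
  ≃mu (f-sound (⇓pair ⇓var ⇓var) df) below
muLoop-sound f f-sound (·itInr (·clo (⇓caseNS _ ()))) below
muLoop-sound f f-sound (·itInl (·clo (⇓caseN0 _ ())) _) below
muLoop-sound f f-sound (·itInl (·clo (⇓caseNS df (⇓inl (⇓suc ⇓var)))) loop) below =
  muLoop-sound f f-sound loop (below-suc below (_ , f-sound (⇓pair ⇓var ⇓var) df))

muLoop-complete : ∀ {n Γ} {ρ : Env Γ} (f : PR (suc n)) → CompileComplete f → ∀ {xs y} →
  f ⟦ y ∷ xs ⟧≃ 0 → (∀ z → z < y → Σ ℕ λ w → f ⟦ z ∷ xs ⟧≃ suc w) →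
  ∀ {y₀} → y₀ ≤‴ y → MuLoop ρ f xs · num y₀ ⇓ num y
muLoop-complete f f-complete F below ≤‴-refl =
  ·itInr (·clo (⇓caseN0 (f-complete (⇓pair ⇓var ⇓var) F) (⇓inr ⇓var)))
muLoop-complete f f-complete F below {y₀} (≤‴-step y₀<‴y) =
  ·itInl (·clo (⇓caseNS (f-complete (⇓pair ⇓var ⇓var) (proj₂ (below y₀ (≤‴⇒≤ y₀<‴y))))
                        (⇓inl (⇓suc ⇓var))))
         (muLoop-complete f f-complete F below y₀<‴y)

mutual
  body-sound : ∀ {n Γ} {ρ : Env Γ} (f : PR n) (xs : Vec ℕ n) {y} →
    (encode xs ∷ ρ) ⊢ body f ⇓ num y → f ⟦ xs ⟧≃ y
  body-sound zeroF xs ⇓zero = ≃zero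
  body-sound succF (x ∷ []) (⇓suc (⇓fst ⇓var)) = ≃succ
  body-sound (proj i) xs d with ⇓-deterministic (projT-⇓ i ⇓var) d
  ... | refl = ≃proj
  body-sound (comp f gs) xs (⇓app ⇓lam dgs (·clo df)) with tuple-sound gs xs dgs
  ... | ys , refl , Gs = ≃comp Gs (body-sound f ys df)
  body-sound (prec g h) (k ∷ xs)
    (⇓app (⇓itco ⇓lam) (⇓pair ⇓zero (⇓pair {a = num _} dg (⇓fst ⇓var))) loop) =
    precLoop-sound g h (compile-sound h) loop (≃prec0 (compile-sound g (⇓snd ⇓var) dg))
  body-sound (mu f) xs (⇓app (⇓itco ⇓lam) ⇓zero loop) =
    muLoop-sound f (compile-sound f) loop (λ _ ())

  compile-sound : ∀ {n} (f : PR n) → CompileSound f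
  compile-sound f du (⇓app ⇓lam du′ (·clo d)) with ⇓-deterministic du du′
  ... | refl = body-sound f _ d

  tuple-sound : ∀ {m n Γ} {ρ : Env Γ} (gs : Vec (PR n) m) (xs : Vec ℕ n) {w} →
    (encode xs ∷ ρ) ⊢ tuple gs ⇓ w → Σ (Vec ℕ m) λ ys → (w ≡ encode ys) × (gs ⟦ xs ⟧*≃ ys)
  tuple-sound [] xs ⇓tt = [] , refl , []
  tuple-sound (g ∷ gs) xs (⇓pair {a = num y} dg dgs) with tuple-sound gs xs dgs
  ... | ys , refl , Gs = y ∷ ys , refl , compile-sound g ⇓var dg ∷ Gs

mutual
  body-complete : ∀ {n Γ} {ρ : Env Γ} (f : PR n) {xs : Vec ℕ n} {y} →
    f ⟦ xs ⟧≃ y → (encode xs ∷ ρ) ⊢ body f ⇓ num y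
  body-complete zeroF ≃zero = ⇓zero
  body-complete succF ≃succ = ⇓suc (⇓fst ⇓var)
  body-complete (proj i) ≃proj = projT-⇓ i ⇓var
  body-complete (comp f gs) (≃comp Gs F) = compile-complete f (tuple-complete gs Gs) F
  body-complete (prec g h) {k ∷ xs} P with prec-defined-below 0 k P
  ... | _ , ≃prec0 G =
    ⇓app (⇓itco ⇓lam) (⇓pair ⇓zero (⇓pair (compile-complete g (⇓snd ⇓var) G) (⇓fst ⇓var)))
         (precLoop-complete g h (compile-complete h) k (≃prec0 G) P)
  body-complete (mu f) (≃mu F below) =
    ⇓app (⇓itco ⇓lam) ⇓zero (muLoop-complete f (compile-complete f) F below 0≤‴n)

  compile-complete : ∀ {n} (f : PR n) → CompileComplete f
  compile-complete f du F = ⇓app ⇓lam du (·clo (body-complete f F))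

  tuple-complete : ∀ {m n Γ} {ρ : Env Γ} (gs : Vec (PR n) m) {xs : Vec ℕ n} {ys} →
    gs ⟦ xs ⟧*≃ ys → (encode xs ∷ ρ) ⊢ tuple gs ⇓ encode ys
  tuple-complete [] [] = ⇓tt
  tuple-complete (g ∷ gs) (G ∷ Gs) = ⇓pair (compile-complete g ⇓var G) (tuple-complete gs Gs)

numeral-⇓ : ∀ {Γ} {ρ : Env Γ} k → ρ ⊢ numeral k ⇓ num k
numeral-⇓ zero    = ⇓zero
numeral-⇓ (suc k) = ⇓suc (numeral-⇓ k)

input-⇓ : ∀ {n} (xs : Vec ℕ n) → [] ⊢ input xs ⇓ encode xs
input-⇓ []       = ⇓tt
input-⇓ (x ∷ xs) = ⇓pair (numeral-⇓ x) (input-⇓ xs)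

theorem1p1 : ∀ {n} (f : PR n) →
    Σ (Tm [] (Natⁿ n ⇒ nat)) λ t →
      (xs : Vec ℕ n) →
        ((y : ℕ) → ([] ⊢ app t (input xs) ⇓ num y) ⇔ (f ⟦ xs ⟧≃ y))
        × (((y : ℕ) → ¬ (f ⟦ xs ⟧≃ y)) → (v : Val nat) → ¬ ([] ⊢ app t (input xs) ⇓ v))
theorem1p1 f = compile f , λ xs →
  (λ y → mk⇔ (compile-sound f (input-⇓ xs)) (compile-complete f (input-⇓ xs))) ,
  λ { undefined (num y) d → undefined y (compile-sound f (input-⇓ xs) d) }
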